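{- Let $a,b$ be integers with $a-1>b\ge 1$, let $u_\beta$ be the fixed point $\lim_{n\to\infty}\varphi^n(0)$ of the substitution $\varphi(0)=0^a1$, $\varphi(1)=0^b1$, let $T(w)=0^b1\varphi(w)0^b$, and define $U^{(1)}=0^{a-1}$, $U^{(n)}=T(U^{(n-1)})$, $V^{(1)}=0^b$, $V^{(n)}=T(V^{(n-1)})$ for $n\ge 2$. Then for every positive integer $n$, $$\mathcal P(n+2)-\mathcal P(n)=\begin{cases}1 & \text{if } n=|V^{(k)}| \text{ for some positive integer } k,\\ -1 & \text{if } n=|U^{(k)}| \text{ for some positive integer } k,\\ 0 & \text{otherwise}.\end{cases}$$
   Context: $\mathcal P(n)$ denotes the number of distinct palindromes of length $n$ that are factors of $u_\beta$ (a palindrome is a word equal to its reversal). $|w|$ is the length of $w$. -}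

module Defs where

open import Data.Nat using (ℕ; zero; suc; _+_; _∸_)
open import Data.List using (List; []; _∷_; _++_; replicate; concatMap; map; upTo; reverse; length; drop)
open import Data.Maybe using (Maybe; just; nothing)
open import Data.Product using (Σ; _×_; ∃)
open import Relation.Binary.PropositionalEquality using (_≡_)
open import Data.List.Relation.Unary.Unique.Propositional using (Unique)
open import Data.List.Membership.Propositional using (_∈_)
open import Function.Bundles using (_⇔_)

data Letter : Set where
  l0 l1 : Letter

module Sturm (a b : ℕ) where

  φ : Letter → List Letter
  φ l0 = replicate a l0 ++ (l1 ∷ [])
  φ l1 = replicate b l0 ++ (l1 ∷ [])

  φ* : List Letter → List Letter
  φ* = concatMap φ

  φⁿ0 : ℕ → List Letter
  φⁿ0 zero    = l0 ∷ []
  φⁿ0 (suc n) = φ* (φⁿ0 n)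

  at : List Letter → ℕ → Letter
  at w i with drop i w
  ... | []    = l0
  ... | x ∷ _ = x

  -- u_β = lim φ^n(0): its i-th letter is the i-th letter of φ^(i+1)(0)
  -- (φ^n(0) is a prefix of φ^(n+1)(0), and |φ^(i+1)(0)| > i, so the default
  -- is never used and this is the fixed point).
  uβ : ℕ → Letter
  uβ i = at (φⁿ0 (suc i)) i

  window : ℕ → ℕ → List Letter
  window i n = map (λ j → uβ (i + j)) (upTo n)

  Factor : List Letter → Set
  Factor w = ∃ λ i → w ≡ window i (length w)

  Palindrome : List Letter → Set
  Palindrome w = reverse w ≡ w

  -- "P(n) = m": the palindromic factors of u_β of length n are exactly the
  -- elements of a duplicate-free list of length m.
  PalCount : ℕ → ℕ → Set
  PalCount n m = Σ (List (List Letter)) λ L →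
      Unique L × length L ≡ m ×
      (∀ w → (w ∈ L) ⇔ (length w ≡ n × Palindrome w × Factor w))

  T : List Letter → List Letter
  T w = replicate b l0 ++ (l1 ∷ []) ++ φ* w ++ replicate b l0

  -- Shifted indexing: U k = U^(k+1), V k = V^(k+1).
  U : ℕ → List Letter
  U zero    = replicate (a ∸ 1) l0
  U (suc k) = T (U k)

  V : ℕ → List Letter
  V zero    = replicate b l0
  V (suc k) = T (V k)

{-# OPTIONS --safe #-}
-- A palindromic factor of u_β that is not a block of zeros has the form
-- T′ i v = 0ⁱ 1 σ(v) 0ⁱ with σ = φ*, where v is a shorter palindromic factor
-- flanked in u_β by letters whose images under φ begin with at least i zeros.
-- Whether 0 w 0 and 1 w 1 are factors for w = T′ i v is decided by i and by the
-- same question for v: T′ b preserves the set of palindromic extensions, while for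
-- i ≠ b exactly one of them exists.  Blocks 0ᵏ behave alike, 0ᵇ and 0ᵃ⁻¹ being
-- the exceptions.  By induction on length, every palindromic factor therefore has
-- exactly one palindromic extension, except V k = Tᵏ(0ᵇ), which has two, and
-- U k = Tᵏ(0ᵃ⁻¹), which has none.  The palindromic factors of length n + 2 are the
-- extensions of those of length n, so P(n + 2) - P(n) is 1, -1 or 0 according as
-- n is some |V k|, some |U k|, or neither; the cases are exclusive because letter
-- counts are monotone under T, giving |V k| < |U k| < |V (k + 1)|.
module Submission where

open import Defs
open import Data.Nat using (ℕ; zero; suc; _+_; _*_; _∸_; _≤_; _<_; z≤n; s≤s)
open import Data.Nat.Properties
open import Data.List using (List; []; _∷_; _++_; _∷ʳ_; replicate; reverse; length; take; drop; applyUpTo; map)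
open import Data.Nat.ListAction using (sum)
open import Data.Integer using (+_; _-_; -_; _⊖_)
open import Data.Integer.Properties using (m-n≡m⊖n; +-cancelˡ-⊖)
open import Data.List.Relation.Unary.All using (All; []; _∷_)
import Data.List.Relation.Unary.All as All
import Data.List.Relation.Unary.All.Properties as AllP
open import Data.List.Relation.Unary.Any using (here; there)
open import Data.List.Relation.Unary.AllPairs using ([]; _∷_)
open import Data.List.Relation.Unary.Unique.Propositional using (Unique)
open import Data.List.Membership.Propositional using (_∈_)
open import Data.List.Membership.Propositional.Properties using (∈-++⁺ˡ; ∈-++⁺ʳ; ∈-map⁻)
import Data.List.Relation.Unary.Unique.Propositional.Properties as Unique
open import Data.List.Properties
open import Data.Product using (Σ; Σ-syntax; ∃; ∃₂; _×_; _,_; proj₁; proj₂)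
open import Data.Sum using (_⊎_; inj₁; inj₂)
open import Data.Empty using (⊥; ⊥-elim)
open import Relation.Binary.PropositionalEquality
open import Function using (_∘_)
open import Function.Bundles using (_⇔_; mk⇔; Equivalence)
open Equivalence using (to; from)
open import Relation.Nullary using (¬_; Dec; yes; no)
open import Relation.Binary.Definitions using (tri<; tri≈; tri>)
open import Induction.WellFounded using (Acc; acc)
open import Data.Nat.Induction using (<-wellFounded)
open import Data.Nat.Tactic.RingSolver using (solve-∀)

private variable
  A : Set

Infix : List A → List A → Set
Infix u w = ∃₂ λ p s → w ≡ p ++ u ++ s

Infix-refl : (w : List A) → Infix w w
Infix-refl w = [] , [] , sym (++-identityʳ w)

Infix-trans : {u v w : List A} → Infix u v → Infix v w → Infix u w
Infix-trans {u = u} (p′ , s′ , refl) (p , s , refl) = p ++ p′ , s′ ++ s , (begin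
  p ++ (p′ ++ u ++ s′) ++ s   ≡⟨ cong (p ++_) (++-assoc p′ (u ++ s′) s) ⟩
  p ++ p′ ++ (u ++ s′) ++ s   ≡⟨ cong (λ t → p ++ p′ ++ t) (++-assoc u s′ s) ⟩
  p ++ p′ ++ u ++ s′ ++ s     ≡⟨ ++-assoc p p′ (u ++ s′ ++ s) ⟨
  (p ++ p′) ++ u ++ s′ ++ s   ∎)
  where open ≡-Reasoning

wrap : A → List A → List A
wrap x w = x ∷ w ++ x ∷ []

length-wrap : ∀ (x : A) w → length (wrap x w) ≡ suc (suc (length w))
length-wrap x w = cong suc (trans (length-++ w) (+-comm (length w) 1))

wrap-injective : ∀ (x : A) u v → wrap x u ≡ wrap x v → u ≡ v
wrap-injective x u v e = ∷ʳ-injectiveˡ u v (∷-injectiveʳ e)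

reverse-∷-∷ʳ : ∀ (x : A) m y → reverse (x ∷ m ++ y ∷ []) ≡ y ∷ reverse m ++ x ∷ []
reverse-∷-∷ʳ x m y = trans (unfold-reverse x (m ++ y ∷ [])) (cong (_∷ʳ x) (reverse-++ m (y ∷ [])))

wrap-palindrome : ∀ (x : A) w → reverse w ≡ w → reverse (wrap x w) ≡ wrap x w
wrap-palindrome x w p = trans (reverse-∷-∷ʳ x w x) (cong (λ t → x ∷ t ++ x ∷ []) p)

palindrome-unwrap : ∀ (x : A) m y → reverse (x ∷ m ++ y ∷ []) ≡ x ∷ m ++ y ∷ [] →
  x ≡ y × reverse m ≡ m
palindrome-unwrap x m y p = sym (∷-injectiveˡ e) , ∷ʳ-injectiveˡ (reverse m) m (∷-injectiveʳ e)
  where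
  e : y ∷ reverse m ++ x ∷ [] ≡ x ∷ m ++ y ∷ []
  e = trans (sym (reverse-∷-∷ʳ x m y)) p

∷-∷ʳ-view : ∀ (c : A) cs → ∃₂ λ ys y → c ∷ cs ≡ ys ∷ʳ y
∷-∷ʳ-view c []       = [] , c , refl
∷-∷ʳ-view c (d ∷ cs) = let ys , y , e = ∷-∷ʳ-view d cs in c ∷ ys , y , cong (c ∷_) e

NonEmpty : List A → Set
NonEmpty w = ∃₂ λ y ys → w ≡ y ∷ ys

++-NonEmpty : ∀ (s : List A) {t} → NonEmpty t → NonEmpty (s ++ t)
++-NonEmpty []      ne = ne
++-NonEmpty (c ∷ s) ne = c , s ++ _ , refl

drop-length-++ : ∀ (p : List A) {s} → drop (length p) (p ++ s) ≡ s
drop-length-++ []      = refl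
drop-length-++ (_ ∷ p) = drop-length-++ p

take-length-++ : ∀ (w : List A) {s} → take (length w) (w ++ s) ≡ w
take-length-++ []      = refl
take-length-++ (c ∷ w) = cong (c ∷_) (take-length-++ w)

module _ (f : ℕ → ℕ) (f-step : ∀ k → f k < f (suc k)) where

  increasing⇒< : ∀ {j k} → j < k → f j < f k
  increasing⇒< {j} {suc k} (s≤s j≤k) with m≤n⇒m<n∨m≡n j≤k
  ... | inj₁ j<k  = <-trans (increasing⇒< j<k) (f-step k)
  ... | inj₂ refl = f-step j

  increasing⇒≤ : ∀ {j k} → j ≤ k → f j ≤ f k
  increasing⇒≤ j≤k with m≤n⇒m<n∨m≡n j≤k
  ... | inj₁ j<k  = <⇒≤ (increasing⇒< j<k)
  ... | inj₂ refl = ≤-refl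

  increasing⇒injective : ∀ {j k} → f j ≡ f k → j ≡ k
  increasing⇒injective {j} {k} e with <-cmp j k
  ... | tri< j<k _ _ = ⊥-elim (<⇒≢ (increasing⇒< j<k) e)
  ... | tri≈ _ j≡k _ = j≡k
  ... | tri> _ _ k<j = ⊥-elim (<⇒≢ (increasing⇒< k<j) (sym e))

sum-map-ones : ∀ (f : A → ℕ) {L} → All (λ e → f e ≡ 1) L → sum (map f L) ≡ length L
sum-map-ones f []         = refl
sum-map-ones f (f≡1 ∷ fs) = cong₂ _+_ f≡1 (sum-map-ones f fs)

sum-map-ones-but-one : ∀ {B : Set} (key : A → B) (f : A → ℕ) {s m} L →
  Unique (map key L) → s ∈ map key L →
  (∀ e → key e ≡ s → f e ≡ m) → All (λ e → key e ≢ s → f e ≡ 1) L →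
  sum (map f L) + 1 ≡ length L + m
sum-map-ones-but-one key f {m = m} (e ∷ L) (key-e∉ ∷ _) (here refl) f≡m (_ ∷ ones) = begin
  f e + sum (map f L) + 1   ≡⟨ cong₂ (λ x y → x + y + 1) (f≡m e refl) (sum-map-ones f others) ⟩
  m + length L + 1          ≡⟨ arith m (length L) ⟩
  suc (length L) + m        ∎
  where
  open ≡-Reasoning
  others : All (λ e′ → f e′ ≡ 1) L
  others = All.zipWith (λ (key-e≢ , one) → one (key-e≢ ∘ sym)) (AllP.map⁻ key-e∉ , ones)
  arith : ∀ m n → m + n + 1 ≡ suc n + m
  arith = solve-∀
sum-map-ones-but-one key f (e ∷ L) (key-e∉ ∷ unique) (there s∈) f≡m (one ∷ ones) =
  trans (cong (λ x → x + sum (map f L) + 1) (one (All.lookup key-e∉ s∈)))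
        (cong suc (sum-map-ones-but-one key f L unique s∈ f≡m ones))

+p-+q≡+m-+1 : ∀ p q m → p + 1 ≡ q + m → + p - + q ≡ + m - + 1
+p-+q≡+m-+1 p q m e = begin
  + p - + q              ≡⟨ m-n≡m⊖n p q ⟩
  p ⊖ q                  ≡⟨ +-cancelˡ-⊖ 1 p q ⟨
  (1 + p) ⊖ (1 + q)      ≡⟨ cong₂ _⊖_ (+-comm 1 p) (+-comm 1 q) ⟩
  (p + 1) ⊖ (q + 1)      ≡⟨ cong (_⊖ (q + 1)) e ⟩
  (q + m) ⊖ (q + 1)      ≡⟨ +-cancelˡ-⊖ q m 1 ⟩
  m ⊖ 1                  ≡⟨ m-n≡m⊖n m 1 ⟨
  + m - + 1              ∎
  where open ≡-Reasoning

-- Binary words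

l1≢l0 : l1 ≢ l0
l1≢l0 ()

head₀ : List Letter → Letter
head₀ []      = l0
head₀ (x ∷ _) = x

head₀-drop-++ : ∀ i x y → i < length x → head₀ (drop i (x ++ y)) ≡ head₀ (drop i x)
head₀-drop-++ zero    (c ∷ x) y _         = refl
head₀-drop-++ (suc i) (c ∷ x) y (s≤s i<) = head₀-drop-++ i x y i<

applyUpTo≡take : ∀ n (g : ℕ → Letter) z → (∀ j → j < n → g j ≡ head₀ (drop j z)) →
  n ≤ length z → applyUpTo g n ≡ take n z
applyUpTo≡take zero    g z       g≡ _         = refl
applyUpTo≡take (suc n) g (x ∷ z) g≡ (s≤s n≤) =
  cong₂ _∷_ (g≡ 0 (s≤s z≤n)) (applyUpTo≡take n (g ∘ suc) z (λ j j< → g≡ (suc j) (s≤s j<)) n≤)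

zeros : ℕ → List Letter
zeros k = replicate k l0

length-zeros : ∀ k → length (zeros k) ≡ k
length-zeros k = length-replicate k

zeros-++ : ∀ m n → zeros m ++ zeros n ≡ zeros (m + n)
zeros-++ zero    n = refl
zeros-++ (suc m) n = cong (l0 ∷_) (zeros-++ m n)

zeros-++-l0∷ : ∀ k s → zeros k ++ l0 ∷ s ≡ zeros (suc k) ++ s
zeros-++-l0∷ zero    s = refl
zeros-++-l0∷ (suc k) s = cong (l0 ∷_) (zeros-++-l0∷ k s)

zeros-∷ʳ : ∀ k → zeros k ∷ʳ l0 ≡ zeros (suc k)
zeros-∷ʳ k = trans (zeros-++-l0∷ k []) (cong (l0 ∷_) (++-identityʳ (zeros k)))

zeros-splitʳ : ∀ {m} i → i ≤ m → zeros m ≡ zeros (m ∸ i) ++ zeros i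
zeros-splitʳ {m} i i≤m = sym (trans (zeros-++ (m ∸ i) i) (cong zeros (m∸n+n≡m i≤m)))

zeros-splitˡ : ∀ {m} i → i ≤ m → zeros m ≡ zeros i ++ zeros (m ∸ i)
zeros-splitˡ {m} i i≤m = sym (trans (zeros-++ i (m ∸ i)) (cong zeros (m+[n∸m]≡n i≤m)))

reverse-zeros : ∀ k → reverse (zeros k) ≡ zeros k
reverse-zeros zero    = refl
reverse-zeros (suc k) =
  trans (unfold-reverse l0 (zeros k)) (trans (cong (_∷ʳ l0) (reverse-zeros k)) (zeros-∷ʳ k))

wrap-l0-zeros : ∀ k → wrap l0 (zeros k) ≡ zeros (suc (suc k))
wrap-l0-zeros k = cong (l0 ∷_) (zeros-∷ʳ k)

data ZerosView : List Letter → Set where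
  all-zeros : ∀ k → ZerosView (zeros k)
  zeros-l1∷ : ∀ i w → ZerosView (zeros i ++ l1 ∷ w)

zerosView : ∀ w → ZerosView w
zerosView []       = all-zeros 0
zerosView (l1 ∷ w) = zeros-l1∷ 0 w
zerosView (l0 ∷ w) with zerosView w
... | all-zeros k    = all-zeros (suc k)
... | zeros-l1∷ i w′ = zeros-l1∷ (suc i) w′

zeros≢-++-l1∷ : ∀ i w y → zeros i ≢ w ++ l1 ∷ y
zeros≢-++-l1∷ zero    []      y ()
zeros≢-++-l1∷ zero    (_ ∷ _) y ()
zeros≢-++-l1∷ (suc i) []      y ()
zeros≢-++-l1∷ (suc i) (_ ∷ w) y e = zeros≢-++-l1∷ i w y (∷-injectiveʳ e)

zeros-l1-injective : ∀ m n x y → zeros m ++ l1 ∷ x ≡ zeros n ++ l1 ∷ y → m ≡ n × x ≡ y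
zeros-l1-injective zero    zero    x y e = refl , ∷-injectiveʳ e
zeros-l1-injective (suc m) (suc n) x y e =
  let m≡n , x≡y = zeros-l1-injective m n x y (∷-injectiveʳ e) in cong suc m≡n , x≡y

++-l1∷-++-assoc : ∀ q w s t → (q ++ l1 ∷ w ++ s) ++ t ≡ q ++ l1 ∷ w ++ s ++ t
++-l1∷-++-assoc q w s t = trans (++-assoc q (l1 ∷ w ++ s) t) (cong (λ u → q ++ l1 ∷ u) (++-assoc w s t))

zeros-l1-split : ∀ m x q y → zeros m ++ l1 ∷ x ≡ q ++ l1 ∷ y →
  (q ≡ zeros m × x ≡ y) ⊎ (∃ λ q′ → q ≡ zeros m ++ l1 ∷ q′ × x ≡ q′ ++ l1 ∷ y)
zeros-l1-split zero    x []       y e = inj₁ (refl , ∷-injectiveʳ e)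
zeros-l1-split zero    x (l1 ∷ q) y e = inj₂ (q , refl , ∷-injectiveʳ e)
zeros-l1-split (suc m) x (l0 ∷ q) y e with zeros-l1-split m x q y (∷-injectiveʳ e)
... | inj₁ (q≡ , x≡)      = inj₁ (cong (l0 ∷_) q≡ , x≡)
... | inj₂ (q′ , q≡ , x≡) = inj₂ (q′ , cong (l0 ∷_) q≡ , x≡)

zeros-l1-prefix : ∀ m x w c s → zeros m ++ l1 ∷ x ≡ w ++ c ∷ s →
  (∃ λ j → w ≡ zeros j × j ≤ m) ⊎ (∃ λ w′ → w ≡ zeros m ++ l1 ∷ w′ × x ≡ w′ ++ c ∷ s)
zeros-l1-prefix m       x []       c s e = inj₁ (0 , refl , z≤n)
zeros-l1-prefix zero    x (l1 ∷ w) c s e = inj₂ (w , refl , ∷-injectiveʳ e)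
zeros-l1-prefix (suc m) x (l0 ∷ w) c s e with zeros-l1-prefix m x w c s (∷-injectiveʳ e)
... | inj₁ (j , w≡ , j≤m) = inj₁ (suc j , cong (l0 ∷_) w≡ , s≤s j≤m)
... | inj₂ (w′ , w≡ , x≡) = inj₂ (w′ , cong (l0 ∷_) w≡ , x≡)

++-zeros≡zeros⇒≤ : ∀ p i m → p ++ zeros i ≡ zeros m → i ≤ m
++-zeros≡zeros⇒≤ p i m e = subst (i ≤_) |p|+i≡m (m≤n+m i (length p))
  where
  |p|+i≡m : length p + i ≡ m
  |p|+i≡m = begin
    length p + i                ≡⟨ cong (_+_ (length p)) (length-zeros i) ⟨
    length p + length (zeros i) ≡⟨ length-++ p ⟨
    length (p ++ zeros i)       ≡⟨ cong length e ⟩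
    length (zeros m)            ≡⟨ length-zeros m ⟩
    m                           ∎
    where open ≡-Reasoning

zeros-suffix-≤ : ∀ w p i m → p ++ zeros i ≡ w ++ l1 ∷ zeros m → i ≤ m
zeros-suffix-≤ []       []      zero    m ()
zeros-suffix-≤ []       []      (suc i) m ()
zeros-suffix-≤ []       (c ∷ p) i       m e = ++-zeros≡zeros⇒≤ p i m (∷-injectiveʳ e)
zeros-suffix-≤ (w ∷ ws) []      i       m e = ⊥-elim (zeros≢-++-l1∷ i (w ∷ ws) (zeros m) e)
zeros-suffix-≤ (w ∷ ws) (c ∷ p) i       m e = zeros-suffix-≤ ws p i m (∷-injectiveʳ e)

#₀ #₁ : List Letter → ℕ
#₀ []       = 0
#₀ (l0 ∷ w) = suc (#₀ w)
#₀ (l1 ∷ w) = #₀ w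
#₁ []       = 0
#₁ (l0 ∷ w) = #₁ w
#₁ (l1 ∷ w) = suc (#₁ w)

length≡#₀+#₁ : ∀ w → length w ≡ #₀ w + #₁ w
length≡#₀+#₁ []       = refl
length≡#₀+#₁ (l0 ∷ w) = cong suc (length≡#₀+#₁ w)
length≡#₀+#₁ (l1 ∷ w) = trans (cong suc (length≡#₀+#₁ w)) (sym (+-suc (#₀ w) (#₁ w)))

#₁≤length : ∀ w → #₁ w ≤ length w
#₁≤length w = subst (#₁ w ≤_) (sym (length≡#₀+#₁ w)) (m≤n+m (#₁ w) (#₀ w))

#₀-++ : ∀ u v → #₀ (u ++ v) ≡ #₀ u + #₀ v
#₀-++ []       v = refl
#₀-++ (l0 ∷ u) v = cong suc (#₀-++ u v)
#₀-++ (l1 ∷ u) v = #₀-++ u v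

#₁-++ : ∀ u v → #₁ (u ++ v) ≡ #₁ u + #₁ v
#₁-++ []       v = refl
#₁-++ (l0 ∷ u) v = #₁-++ u v
#₁-++ (l1 ∷ u) v = cong suc (#₁-++ u v)

#₀-zeros : ∀ k → #₀ (zeros k) ≡ k
#₀-zeros zero    = refl
#₀-zeros (suc k) = cong suc (#₀-zeros k)

#₁-zeros : ∀ k → #₁ (zeros k) ≡ 0
#₁-zeros zero    = refl
#₁-zeros (suc k) = #₁-zeros k

module Substitution (a b : ℕ) where
  open Sturm a b

  run : Letter → ℕ
  run l0 = a
  run l1 = b

  σ : List Letter → List Letter
  σ []      = []
  σ (c ∷ v) = zeros (run c) ++ l1 ∷ σ v

  φ*≗σ : ∀ v → φ* v ≡ σ v
  φ*≗σ []      = refl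
  φ*≗σ (c ∷ v) = begin
    φ c ++ φ* v                        ≡⟨ cong (_++ φ* v) (φ≡ c) ⟩
    (zeros (run c) ++ l1 ∷ []) ++ φ* v ≡⟨ ++-assoc (zeros (run c)) (l1 ∷ []) (φ* v) ⟩
    zeros (run c) ++ l1 ∷ φ* v         ≡⟨ cong (λ t → zeros (run c) ++ l1 ∷ t) (φ*≗σ v) ⟩
    σ (c ∷ v)                          ∎
    where
    open ≡-Reasoning
    φ≡ : ∀ c → φ c ≡ zeros (run c) ++ l1 ∷ []
    φ≡ l0 = refl
    φ≡ l1 = refl

  σ-++ : ∀ u v → σ (u ++ v) ≡ σ u ++ σ v
  σ-++ []      v = refl
  σ-++ (c ∷ u) v = trans (cong (λ t → zeros (run c) ++ l1 ∷ t) (σ-++ u v))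
                         (sym (++-assoc (zeros (run c)) (l1 ∷ σ u) (σ v)))

  σ-∷ʳ : ∀ v y → σ (v ∷ʳ y) ≡ σ v ++ zeros (run y) ++ l1 ∷ []
  σ-∷ʳ v y = σ-++ v (y ∷ [])

  σ-∷-∷ʳ : ∀ c z → ∃ λ w → σ (c ∷ z) ≡ w ∷ʳ l1
  σ-∷-∷ʳ c []      = zeros (run c) , refl
  σ-∷-∷ʳ c (d ∷ z) =
    let w , e = σ-∷-∷ʳ d z
    in zeros (run c) ++ l1 ∷ w ,
       trans (cong (λ t → zeros (run c) ++ l1 ∷ t) e) (sym (++-assoc (zeros (run c)) (l1 ∷ w) _))

  reverse-l1∷σ : ∀ v → reverse (l1 ∷ σ v) ≡ l1 ∷ σ (reverse v)
  reverse-l1∷σ []      = refl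
  reverse-l1∷σ (c ∷ v) = begin
    reverse ((l1 ∷ zeros (run c)) ++ l1 ∷ σ v)
      ≡⟨ reverse-++ (l1 ∷ zeros (run c)) (l1 ∷ σ v) ⟩
    reverse (l1 ∷ σ v) ++ reverse (l1 ∷ zeros (run c))
      ≡⟨ cong₂ _++_ (reverse-l1∷σ v)
           (trans (unfold-reverse l1 (zeros (run c))) (cong (_∷ʳ l1) (reverse-zeros (run c)))) ⟩
    l1 ∷ σ (reverse v) ++ zeros (run c) ++ l1 ∷ []
      ≡⟨ cong (l1 ∷_) (σ-∷ʳ (reverse v) c) ⟨
    l1 ∷ σ (reverse v ∷ʳ c)
      ≡⟨ cong (λ t → l1 ∷ σ t) (unfold-reverse c v) ⟨
    l1 ∷ σ (reverse (c ∷ v)) ∎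
    where open ≡-Reasoning

  Infix-σ : ∀ {u w} → Infix u w → Infix (σ u) (σ w)
  Infix-σ {u} (p , s , refl) = σ p , σ s , trans (σ-++ p (u ++ s)) (cong (σ p ++_) (σ-++ u s))

  σ-split-at-l1 : ∀ z q s → σ z ≡ q ++ l1 ∷ s →
    Σ[ z₁ ∈ List Letter ] Σ[ x ∈ Letter ] Σ[ z₂ ∈ List Letter ]
      z ≡ z₁ ++ x ∷ z₂ × q ≡ σ z₁ ++ zeros (run x) × s ≡ σ z₂
  σ-split-at-l1 []      []      s ()
  σ-split-at-l1 []      (_ ∷ _) s ()
  σ-split-at-l1 (c ∷ z) q       s e with zeros-l1-split (run c) (σ z) q s e
  ... | inj₁ (q≡ , s≡) = [] , c , z , refl , q≡ , sym s≡
  ... | inj₂ (q′ , q≡ , σz≡) =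
    let z₁ , x , z₂ , z≡ , q′≡ , s≡ = σ-split-at-l1 z q′ s σz≡
    in c ∷ z₁ , x , z₂ , cong (c ∷_) z≡ ,
       trans q≡ (trans (cong (λ t → zeros (run c) ++ l1 ∷ t) q′≡)
                       (sym (++-assoc (zeros (run c)) (l1 ∷ σ z₁) _))) ,
       s≡

  σ-prefix : ∀ z w c s → σ z ≡ w ++ c ∷ s →
    Σ[ v ∈ List Letter ] Σ[ y ∈ Letter ] Σ[ z′ ∈ List Letter ] Σ[ j ∈ ℕ ]
      z ≡ v ++ y ∷ z′ × w ≡ σ v ++ zeros j × j ≤ run y
  σ-prefix []      []      c s ()
  σ-prefix []      (_ ∷ _) c s ()
  σ-prefix (y ∷ z) w       c s e with zeros-l1-prefix (run y) (σ z) w c s e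
  ... | inj₁ (j , w≡ , j≤) = [] , y , z , j , refl , w≡ , j≤
  ... | inj₂ (w′ , w≡ , σz≡) =
    let v , y′ , z′ , j , z≡ , w′≡ , j≤ = σ-prefix z w′ c s σz≡
    in y ∷ v , y′ , z′ , j , cong (y ∷_) z≡ ,
       trans w≡ (trans (cong (λ t → zeros (run y) ++ l1 ∷ t) w′≡)
                       (sym (++-assoc (zeros (run y)) (l1 ∷ σ v) _))) ,
       j≤

  σ-zeros-suffix-≤ : ∀ p i z m → p ++ zeros i ≡ σ z ++ zeros m → i ≤ m
  σ-zeros-suffix-≤ p i []      m e = ++-zeros≡zeros⇒≤ p i m e
  σ-zeros-suffix-≤ p i (c ∷ z) m e =
    let w , σ≡ = σ-∷-∷ʳ c z
    in zeros-suffix-≤ w p i m (trans e (trans (cong (_++ zeros m) σ≡) (++-assoc w (l1 ∷ []) (zeros m))))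

  run-≤ : b ≤ a → ∀ c → run c ≤ a
  run-≤ b≤a l0 = ≤-refl
  run-≤ b≤a l1 = b≤a

  σ-zero-run-≤ : b ≤ a → ∀ z q k s → σ z ≡ q ++ zeros k ++ s → k ≤ a
  σ-zero-run-≤ b≤a z q k (l1 ∷ s) e =
    let z₁ , x , _ , _ , q0ᵏ≡ , _ = σ-split-at-l1 z (q ++ zeros k) s (trans e (sym (++-assoc q (zeros k) _)))
    in ≤-trans (σ-zeros-suffix-≤ q k z₁ (run x) q0ᵏ≡) (run-≤ b≤a x)
  σ-zero-run-≤ b≤a z q k (l0 ∷ s) e =
    ≤-trans (n≤1+n k) (σ-zero-run-≤ b≤a z q (suc k) s (trans e (cong (q ++_) (zeros-++-l0∷ k s))))
  σ-zero-run-≤ b≤a z       q zero    [] e = z≤n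
  σ-zero-run-≤ b≤a []      [] (suc k) [] ()
  σ-zero-run-≤ b≤a []      (_ ∷ _) (suc k) [] ()
  σ-zero-run-≤ b≤a (c ∷ z) q (suc k) [] e =
    let w , σ≡ = σ-∷-∷ʳ c z
    in ⊥-elim (l1≢l0 (∷ʳ-injectiveʳ w (q ++ zeros k) (trans (sym σ≡) (trans e ends-in-l0))))
    where
    ends-in-l0 : q ++ zeros (suc k) ++ [] ≡ (q ++ zeros k) ∷ʳ l0
    ends-in-l0 = trans (cong (q ++_) (trans (++-identityʳ _) (sym (zeros-∷ʳ k)))) (sym (++-assoc q (zeros k) _))

  run-injective : a ≢ b → ∀ c c′ → run c ≡ run c′ → c ≡ c′
  run-injective a≢b l0 l0 e = refl
  run-injective a≢b l0 l1 e = ⊥-elim (a≢b e)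
  run-injective a≢b l1 l0 e = ⊥-elim (a≢b (sym e))
  run-injective a≢b l1 l1 e = refl

  σ-++-zeros-injective : a ≢ b → ∀ v v′ j j′ → σ v ++ zeros j ≡ σ v′ ++ zeros j′ → v ≡ v′ × j ≡ j′
  σ-++-zeros-injective a≢b []      []       j j′ e =
    refl , trans (sym (length-zeros j)) (trans (cong length e) (length-zeros j′))
  σ-++-zeros-injective a≢b []      (c ∷ v′) j j′ e =
    ⊥-elim (zeros≢-++-l1∷ j (zeros (run c)) _ (trans e (++-assoc (zeros (run c)) _ (zeros j′))))
  σ-++-zeros-injective a≢b (c ∷ v) []       j j′ e =
    ⊥-elim (zeros≢-++-l1∷ j′ (zeros (run c)) _ (trans (sym e) (++-assoc (zeros (run c)) _ (zeros j))))
  σ-++-zeros-injective a≢b (c ∷ v) (c′ ∷ v′) j j′ e =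
    let runs≡ , rest≡ = zeros-l1-injective (run c) (run c′) _ _
          (trans (sym (++-assoc (zeros (run c)) _ (zeros j))) (trans e (++-assoc (zeros (run c′)) _ (zeros j′))))
        v≡ , j≡ = σ-++-zeros-injective a≢b v v′ j j′ rest≡
    in cong₂ _∷_ (run-injective a≢b c c′ runs≡) v≡ , j≡

  σ-++-zeros≡zeros-l1∷ : ∀ v j k s → σ v ++ zeros j ≡ zeros k ++ l1 ∷ s →
    Σ[ c ∈ Letter ] Σ[ v′ ∈ List Letter ] v ≡ c ∷ v′ × run c ≡ k × σ v′ ++ zeros j ≡ s
  σ-++-zeros≡zeros-l1∷ []      j k s e = ⊥-elim (zeros≢-++-l1∷ j (zeros k) s e)
  σ-++-zeros≡zeros-l1∷ (c ∷ v) j k s e =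
    let run≡ , s≡ = zeros-l1-injective (run c) k _ _ (trans (sym (++-assoc (zeros (run c)) _ (zeros j))) e)
    in c , v , refl , run≡ , s≡

  T′ : ℕ → List Letter → List Letter
  T′ i v = zeros i ++ l1 ∷ σ v ++ zeros i

  T≡T′b : ∀ v → T v ≡ T′ b v
  T≡T′b v = cong (λ t → zeros b ++ l1 ∷ t ++ zeros b) (φ*≗σ v)

  wrap-l0-T′ : ∀ i v → wrap l0 (T′ i v) ≡ T′ (suc i) v
  wrap-l0-T′ i v = cong (l0 ∷_) (trans (++-l1∷-++-assoc (zeros i) (σ v) (zeros i) (l0 ∷ []))
    (cong (λ t → zeros i ++ l1 ∷ σ v ++ t) (zeros-∷ʳ i)))

  wrap-l1-T′ : ∀ c v → wrap l1 (T′ (run c) v) ≡ T′ 0 (wrap c v)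
  wrap-l1-T′ c v = cong (l1 ∷_) (trans (++-l1∷-++-assoc (zeros (run c)) (σ v) (zeros (run c)) (l1 ∷ []))
    (sym (trans (++-identityʳ _) (cong (λ t → zeros (run c) ++ l1 ∷ t) (σ-∷ʳ v c)))))

  wrap-l1-zeros : ∀ c → wrap l1 (zeros (run c)) ≡ T′ 0 (c ∷ [])
  wrap-l1-zeros c = cong (l1 ∷_) (sym (++-identityʳ _))

  reverse-zeros-l1∷σ-++-zeros : ∀ i v j →
    reverse (zeros i ++ l1 ∷ σ v ++ zeros j) ≡ zeros j ++ l1 ∷ σ (reverse v) ++ zeros i
  reverse-zeros-l1∷σ-++-zeros i v j = begin
    reverse (zeros i ++ (l1 ∷ σ v) ++ zeros j)
      ≡⟨ reverse-++ (zeros i) _ ⟩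
    reverse ((l1 ∷ σ v) ++ zeros j) ++ reverse (zeros i)
      ≡⟨ cong₂ _++_ (reverse-++ (l1 ∷ σ v) (zeros j)) (reverse-zeros i) ⟩
    (reverse (zeros j) ++ reverse (l1 ∷ σ v)) ++ zeros i
      ≡⟨ cong (λ t → (t ++ reverse (l1 ∷ σ v)) ++ zeros i) (reverse-zeros j) ⟩
    (zeros j ++ reverse (l1 ∷ σ v)) ++ zeros i
      ≡⟨ cong (λ t → (zeros j ++ t) ++ zeros i) (reverse-l1∷σ v) ⟩
    (zeros j ++ l1 ∷ σ (reverse v)) ++ zeros i
      ≡⟨ ++-assoc (zeros j) _ (zeros i) ⟩
    zeros j ++ l1 ∷ σ (reverse v) ++ zeros i ∎
    where open ≡-Reasoning

  T′-palindrome : ∀ i v → Palindrome v → Palindrome (T′ i v)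
  T′-palindrome i v p = trans (reverse-zeros-l1∷σ-++-zeros i v i) (cong (λ t → T′ i t) p)

  palindrome-zeros-l1∷σ-++-zeros : a ≢ b → ∀ i v j → Palindrome (zeros i ++ l1 ∷ σ v ++ zeros j) →
    i ≡ j × Palindrome v
  palindrome-zeros-l1∷σ-++-zeros a≢b i v j p =
    let j≡i , rest≡ = zeros-l1-injective j i _ _ (trans (sym (reverse-zeros-l1∷σ-++-zeros i v j)) p)
    in sym j≡i , proj₁ (σ-++-zeros-injective a≢b (reverse v) v i j rest≡)

  Infix-zeros-l1∷σ-++-zeros : ∀ i j v x y → i ≤ run x → j ≤ run y →
    Infix (zeros i ++ l1 ∷ σ v ++ zeros j) (σ (x ∷ v ++ y ∷ []))
  Infix-zeros-l1∷σ-++-zeros i j v x y i≤ j≤ = zeros (run x ∸ i) , zeros (run y ∸ j) ++ l1 ∷ [] , (begin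
    zeros (run x) ++ l1 ∷ σ (v ++ y ∷ [])
      ≡⟨ cong₂ (λ s t → s ++ l1 ∷ t) (zeros-splitʳ i i≤)
           (trans (σ-∷ʳ v y) (cong (λ t → σ v ++ t ++ l1 ∷ []) (zeros-splitˡ j j≤))) ⟩
    (zeros (run x ∸ i) ++ zeros i) ++ l1 ∷ σ v ++ (zeros j ++ zeros (run y ∸ j)) ++ l1 ∷ []
      ≡⟨ ++-assoc (zeros (run x ∸ i)) (zeros i) _ ⟩
    zeros (run x ∸ i) ++ zeros i ++ l1 ∷ σ v ++ (zeros j ++ zeros (run y ∸ j)) ++ l1 ∷ []
      ≡⟨ cong (λ t → zeros (run x ∸ i) ++ zeros i ++ l1 ∷ σ v ++ t) (++-assoc (zeros j) _ (l1 ∷ [])) ⟩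
    zeros (run x ∸ i) ++ zeros i ++ l1 ∷ σ v ++ zeros j ++ zeros (run y ∸ j) ++ l1 ∷ []
      ≡⟨ cong (zeros (run x ∸ i) ++_) (++-l1∷-++-assoc (zeros i) (σ v) (zeros j) _) ⟨
    zeros (run x ∸ i) ++ (zeros i ++ l1 ∷ σ v ++ zeros j) ++ zeros (run y ∸ j) ++ l1 ∷ [] ∎)
    where open ≡-Reasoning

  -- The letter c after the occurrence ensures that its trailing zeros lie in the image of a letter y of z.
  σ-desubstitute : ∀ z p i w c s → σ z ≡ p ++ (zeros i ++ l1 ∷ w) ++ c ∷ s →
    Σ[ v ∈ List Letter ] Σ[ j ∈ ℕ ] Σ[ x ∈ Letter ] Σ[ y ∈ Letter ]
      w ≡ σ v ++ zeros j × Infix (x ∷ v ++ y ∷ []) z × i ≤ run x × j ≤ run y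
  σ-desubstitute z p i w c s e =
    let z₁ , x , z₂ , z≡ , p0ⁱ≡ , σz₂≡ = σ-split-at-l1 z (p ++ zeros i) (w ++ c ∷ s) split-at-l1
        v , y , z₃ , j , z₂≡ , w≡ , j≤ = σ-prefix z₂ w c s (sym σz₂≡)
    in v , j , x , y , w≡ ,
       (z₁ , z₃ , trans z≡ (cong (λ t → z₁ ++ x ∷ t) (trans z₂≡ (sym (++-assoc v (y ∷ []) z₃))))) ,
       σ-zeros-suffix-≤ p i z₁ (run x) p0ⁱ≡ , j≤
    where
    split-at-l1 : σ z ≡ (p ++ zeros i) ++ l1 ∷ w ++ c ∷ s
    split-at-l1 = trans e (trans (cong (p ++_) (++-assoc (zeros i) (l1 ∷ w) (c ∷ s)))
                                 (sym (++-assoc p (zeros i) _)))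

  #₀-σ : ∀ v → #₀ (σ v) ≡ a * #₀ v + b * #₁ v
  #₀-σ []       = sym (cong₂ _+_ (*-zeroʳ a) (*-zeroʳ b))
  #₀-σ (l0 ∷ v) = begin
    #₀ (zeros a ++ l1 ∷ σ v)     ≡⟨ #₀-++ (zeros a) (l1 ∷ σ v) ⟩
    #₀ (zeros a) + #₀ (σ v)      ≡⟨ cong₂ _+_ (#₀-zeros a) (#₀-σ v) ⟩
    a + (a * #₀ v + b * #₁ v)    ≡⟨ arith a b (#₀ v) (#₁ v) ⟩
    a * suc (#₀ v) + b * #₁ v    ∎
    where
    open ≡-Reasoning
    arith : ∀ a b x y → a + (a * x + b * y) ≡ a * suc x + b * y
    arith = solve-∀
  #₀-σ (l1 ∷ v) = begin
    #₀ (zeros b ++ l1 ∷ σ v)     ≡⟨ #₀-++ (zeros b) (l1 ∷ σ v) ⟩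
    #₀ (zeros b) + #₀ (σ v)      ≡⟨ cong₂ _+_ (#₀-zeros b) (#₀-σ v) ⟩
    b + (a * #₀ v + b * #₁ v)    ≡⟨ arith a b (#₀ v) (#₁ v) ⟩
    a * #₀ v + b * suc (#₁ v)    ∎
    where
    open ≡-Reasoning
    arith : ∀ a b x y → b + (a * x + b * y) ≡ a * x + b * suc y
    arith = solve-∀

  #₁-σ : ∀ v → #₁ (σ v) ≡ length v
  #₁-σ []      = refl
  #₁-σ (c ∷ v) = trans (#₁-++ (zeros (run c)) (l1 ∷ σ v)) (cong₂ _+_ (#₁-zeros (run c)) (cong suc (#₁-σ v)))

  #₀-T′ : ∀ i v → #₀ (T′ i v) ≡ i + (#₀ (σ v) + i)
  #₀-T′ i v = trans (#₀-++ (zeros i) _)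
    (cong₂ _+_ (#₀-zeros i) (trans (#₀-++ (σ v) (zeros i)) (cong (_+_ (#₀ (σ v))) (#₀-zeros i))))

  #₁-T′ : ∀ i v → #₁ (T′ i v) ≡ suc (length v)
  #₁-T′ i v = begin
    #₁ (zeros i ++ l1 ∷ σ v ++ zeros i)          ≡⟨ #₁-++ (zeros i) _ ⟩
    #₁ (zeros i) + suc (#₁ (σ v ++ zeros i))     ≡⟨ cong₂ (λ s t → s + suc t) (#₁-zeros i) (#₁-++ (σ v) (zeros i)) ⟩
    suc (#₁ (σ v) + #₁ (zeros i))                ≡⟨ cong₂ (λ s t → suc (s + t)) (#₁-σ v) (#₁-zeros i) ⟩
    suc (length v + 0)                           ≡⟨ cong suc (+-identityʳ (length v)) ⟩
    suc (length v)                               ∎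
    where open ≡-Reasoning

  record _≺_ (u w : List Letter) : Set where
    constructor ≺-intro
    field
      #₀-≤     : #₀ u ≤ #₀ w
      #₁-≤     : #₁ u ≤ #₁ w
      length-< : length u < length w

  open _≺_ public

  ≺-from-counts : ∀ {u w} → #₀ u ≤ #₀ w → #₁ u < #₁ w → u ≺ w
  ≺-from-counts {u} {w} #₀≤ #₁< =
    ≺-intro #₀≤ (<⇒≤ #₁<) (subst₂ _<_ (sym (length≡#₀+#₁ u)) (sym (length≡#₀+#₁ w)) (+-mono-≤-< #₀≤ #₁<))

  T′-mono-≺ : ∀ i {u w} → u ≺ w → T′ i u ≺ T′ i w
  T′-mono-≺ i {u} {w} (≺-intro #₀≤ #₁≤ |u|<|w|) = ≺-from-counts
    (subst₂ _≤_ (sym (#₀-T′ i u)) (sym (#₀-T′ i w))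
      (+-monoʳ-≤ i (+-monoˡ-≤ i (subst₂ _≤_ (sym (#₀-σ u)) (sym (#₀-σ w))
        (+-mono-≤ (*-monoʳ-≤ a #₀≤) (*-monoʳ-≤ b #₁≤))))))
    (subst₂ _<_ (sym (#₁-T′ i u)) (sym (#₁-T′ i w)) (s≤s |u|<|w|))

-- a = a′ + 3 and b = b′ + 1 turn the hypothesis 1 ≤ b < a - 1 into b′ ≤ a′, and make a ∸ 1 compute.
module PalindromicFactors (a′ b′ : ℕ) (b′≤a′ : b′ ≤ a′) where
  a b : ℕ
  a = 3 + a′
  b = 1 + b′

  open Sturm a b
  open Substitution a b

  b<a-1 : b < a ∸ 1
  b<a-1 = s≤s (s≤s b′≤a′)

  b<a : b < a
  b<a = <-trans b<a-1 (n<1+n (a ∸ 1))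

  b≤a : b ≤ a
  b≤a = <⇒≤ b<a

  a≢b : a ≢ b
  a≢b = >⇒≢ b<a

  b≤run : ∀ c → b ≤ run c
  b≤run l0 = b≤a
  b≤run l1 = ≤-refl

  -- u_β as the limit of the words φⁿ(0)

  σⁿ : ℕ → List Letter → List Letter
  σⁿ zero    w = w
  σⁿ (suc n) w = σ (σⁿ n w)

  σⁿ0 : ℕ → List Letter
  σⁿ0 n = σⁿ n (l0 ∷ [])

  φⁿ0≡σⁿ0 : ∀ n → φⁿ0 n ≡ σⁿ0 n
  φⁿ0≡σⁿ0 zero    = refl
  φⁿ0≡σⁿ0 (suc n) = trans (φ*≗σ (φⁿ0 n)) (cong σ (φⁿ0≡σⁿ0 n))

  σⁿ-++ : ∀ n u v → σⁿ n (u ++ v) ≡ σⁿ n u ++ σⁿ n v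
  σⁿ-++ zero    u v = refl
  σⁿ-++ (suc n) u v = trans (cong σ (σⁿ-++ n u v)) (σ-++ (σⁿ n u) (σⁿ n v))

  σⁿ-suc : ∀ n w → σⁿ (suc n) w ≡ σⁿ n (σ w)
  σⁿ-suc zero    w = refl
  σⁿ-suc (suc n) w = cong σ (σⁿ-suc n w)

  σⁿ-∷ : ∀ n x xs → NonEmpty (σⁿ n (x ∷ xs))
  σⁿ-∷ zero    x xs = x , xs , refl
  σⁿ-∷ (suc n) x xs with σⁿ-∷ n x xs
  ... | l0 , ys , e = _ , _ , cong σ e
  ... | l1 , ys , e = _ , _ , cong σ e

  σⁿ0-rest : ℕ → List Letter
  σⁿ0-rest n = σⁿ n (l0 ∷ zeros a′ ++ l1 ∷ [])

  -- φ(0) = 0 0 (0^(a-2) 1): this is where a ≥ 2 is used.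
  σⁿ0-suc : ∀ n → σⁿ0 (suc n) ≡ σⁿ0 n ++ σⁿ0 n ++ σⁿ0-rest n
  σⁿ0-suc n = trans (σⁿ-suc n (l0 ∷ []))
    (trans (σⁿ-++ n (l0 ∷ []) _) (cong (σⁿ0 n ++_) (σⁿ-++ n (l0 ∷ []) _)))

  σⁿ0-prefix : ∀ m k → ∃ λ t → σⁿ0 (k + m) ≡ σⁿ0 m ++ t
  σⁿ0-prefix m zero    = [] , sym (++-identityʳ (σⁿ0 m))
  σⁿ0-prefix m (suc k) =
    let t , e = σⁿ0-prefix m k
    in t ++ σⁿ0 (k + m) ++ σⁿ0-rest (k + m) ,
       trans (σⁿ0-suc (k + m)) (trans (cong (_++ (σⁿ0 (k + m) ++ σⁿ0-rest (k + m))) e) (++-assoc (σⁿ0 m) t _))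

  length-σⁿ0 : ∀ n → n < length (σⁿ0 n)
  length-σⁿ0 zero    = s≤s z≤n
  length-σⁿ0 (suc n) = begin
    1 + suc n                                        ≤⟨ +-mono-≤ (≤-trans (s≤s z≤n) IH) IH ⟩
    ℓ + ℓ                                            ≤⟨ +-monoʳ-≤ ℓ (m≤m+n ℓ (length (σⁿ0-rest n))) ⟩
    ℓ + (ℓ + length (σⁿ0-rest n))                    ≡⟨ cong (_+_ ℓ) (length-++ (σⁿ0 n)) ⟨
    ℓ + length (σⁿ0 n ++ σⁿ0-rest n)                 ≡⟨ length-++ (σⁿ0 n) ⟨
    length (σⁿ0 n ++ σⁿ0 n ++ σⁿ0-rest n)            ≡⟨ cong length (σⁿ0-suc n) ⟨
    length (σⁿ0 (suc n))                             ∎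
    where
    open ≤-Reasoning
    ℓ = length (σⁿ0 n)
    IH : suc n ≤ ℓ
    IH = length-σⁿ0 n

  head₀-drop-σⁿ0-stable : ∀ {m n} i → m ≤ n → i < length (σⁿ0 m) →
    head₀ (drop i (σⁿ0 m)) ≡ head₀ (drop i (σⁿ0 n))
  head₀-drop-σⁿ0-stable {m} {n} i m≤n i< with σⁿ0-prefix m (n ∸ m)
  ... | t , e rewrite m∸n+n≡m m≤n | e = sym (head₀-drop-++ i (σⁿ0 m) t i<)

  uβ≡head₀-drop-σⁿ0 : ∀ i n → i < length (σⁿ0 n) → uβ i ≡ head₀ (drop i (σⁿ0 n))
  uβ≡head₀-drop-σⁿ0 i n i< = trans (at≡head₀-drop _ i) (trans (cong (head₀ ∘ drop i) (φⁿ0≡σⁿ0 (suc i)))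
    (stable (≤-total (suc i) n)))
    where
    at≡head₀-drop : ∀ w i → at w i ≡ head₀ (drop i w)
    at≡head₀-drop w i with drop i w
    ... | []    = refl
    ... | _ ∷ _ = refl
    stable : suc i ≤ n ⊎ n ≤ suc i → head₀ (drop i (σⁿ0 (suc i))) ≡ head₀ (drop i (σⁿ0 n))
    stable (inj₁ ≤n) = head₀-drop-σⁿ0-stable i ≤n (<⇒≤ (length-σⁿ0 (suc i)))
    stable (inj₂ n≤) = sym (head₀-drop-σⁿ0-stable i n≤ i<)

  window≡take-drop-σⁿ0 : ∀ i n N → i + n ≤ length (σⁿ0 N) → window i n ≡ take n (drop i (σⁿ0 N))
  window≡take-drop-σⁿ0 i n N ≤ℓ = trans (map-upTo (λ j → uβ (i + j)) n)
    (applyUpTo≡take n (λ j → uβ (i + j)) (drop i (σⁿ0 N)) letters n≤)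
    where
    letters : ∀ j → j < n → uβ (i + j) ≡ head₀ (drop j (drop i (σⁿ0 N)))
    letters j j< = trans (uβ≡head₀-drop-σⁿ0 (i + j) N (<-≤-trans (+-monoʳ-< i j<) ≤ℓ))
                         (cong head₀ (sym (drop-drop i j (σⁿ0 N))))
    n≤ : n ≤ length (drop i (σⁿ0 N))
    n≤ = subst (n ≤_) (sym (length-drop i (σⁿ0 N)))
               (subst (_≤ length (σⁿ0 N) ∸ i) (m+n∸m≡n i n) (∸-monoˡ-≤ i ≤ℓ))

  Factor′ : List Letter → Set
  Factor′ w = ∃ λ N → Infix w (σⁿ0 N)

  Factor⇒Factor′ : ∀ w → Factor w → Factor′ w
  Factor⇒Factor′ w (i , w≡) = N , take i Y , drop n (drop i Y) , (begin
    Y                                                   ≡⟨ take++drop≡id i Y ⟨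
    take i Y ++ drop i Y                                ≡⟨ cong (take i Y ++_) (take++drop≡id n (drop i Y)) ⟨
    take i Y ++ take n (drop i Y) ++ drop n (drop i Y)  ≡⟨ cong (λ t → take i Y ++ t ++ drop n (drop i Y)) w≡′ ⟨
    take i Y ++ w ++ drop n (drop i Y)                  ∎)
    where
    open ≡-Reasoning
    n = length w
    N = i + n
    Y = σⁿ0 N
    w≡′ : w ≡ take n (drop i Y)
    w≡′ = trans w≡ (window≡take-drop-σⁿ0 i n N (<⇒≤ (length-σⁿ0 N)))

  Factor′⇒Factor : ∀ w → Factor′ w → Factor w
  Factor′⇒Factor w (N , p , s , e) = length p , sym (begin
    window (length p) (length w)                        ≡⟨ window≡take-drop-σⁿ0 (length p) (length w) N ≤ℓ ⟩
    take (length w) (drop (length p) (σⁿ0 N))           ≡⟨ cong (take (length w) ∘ drop (length p)) e ⟩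
    take (length w) (drop (length p) (p ++ w ++ s))     ≡⟨ cong (take (length w)) (drop-length-++ p) ⟩
    take (length w) (w ++ s)                            ≡⟨ take-length-++ w ⟩
    w                                                   ∎)
    where
    open ≡-Reasoning
    ≤ℓ : length p + length w ≤ length (σⁿ0 N)
    ≤ℓ = subst (length p + length w ≤_)
               (sym (trans (cong length e) (trans (length-++ p) (cong (_+_ (length p)) (length-++ w)))))
               (+-monoʳ-≤ (length p) (m≤m+n (length w) (length s)))

  -- Desubstitution of factors

  Factor′-infix : ∀ {u w} → Factor′ w → Infix u w → Factor′ u
  Factor′-infix (N , w⊑) u⊑ = N , Infix-trans u⊑ w⊑

  Factor′-[] : Factor′ []
  Factor′-[] = 0 , [] , l0 ∷ [] , refl

  Factor′-letter : ∀ c → Factor′ (c ∷ [])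
  Factor′-letter l0 = 0 , Infix-refl _
  Factor′-letter l1 = 1 , zeros a , [] , refl

  Factor′-extend : ∀ {v} → Factor′ v → ∃₂ λ x y → Factor′ (x ∷ v ++ y ∷ [])
  Factor′-extend {v} (N , p , s , e)
    with σⁿ-∷ N l0 [] | ++-NonEmpty s (σⁿ-∷ N l0 (zeros a′ ++ l1 ∷ []))
  ... | c , cs , σⁿ0≡ | y , t , s++rest≡ =
    let ys , x , c∷cs++p≡ = ∷-∷ʳ-view c (cs ++ p)
    in x , y , suc N , ys , t , (begin
      σⁿ0 (suc N)                                   ≡⟨ σⁿ0-suc N ⟩
      σⁿ0 N ++ σⁿ0 N ++ σⁿ0-rest N                  ≡⟨ cong₂ (λ q r → q ++ r ++ σⁿ0-rest N) σⁿ0≡ e ⟩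
      (c ∷ cs) ++ (p ++ v ++ s) ++ σⁿ0-rest N       ≡⟨ cong ((c ∷ cs) ++_) (++-assoc p (v ++ s) _) ⟩
      (c ∷ cs) ++ p ++ (v ++ s) ++ σⁿ0-rest N       ≡⟨ ++-assoc (c ∷ cs) p _ ⟨
      (c ∷ cs ++ p) ++ (v ++ s) ++ σⁿ0-rest N       ≡⟨ cong₂ _++_ c∷cs++p≡ (trans (++-assoc v s _) (cong (v ++_) s++rest≡)) ⟩
      (ys ∷ʳ x) ++ v ++ y ∷ t                       ≡⟨ ++-assoc ys (x ∷ []) _ ⟩
      ys ++ x ∷ v ++ y ∷ t                          ≡⟨ cong (λ r → ys ++ x ∷ r) (++-assoc v (y ∷ []) t) ⟨
      ys ++ (x ∷ v ++ y ∷ []) ++ t                  ∎)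
    where open ≡-Reasoning

  Factor′-inside-σ : ∀ {w} → Factor′ w →
    Σ[ N ∈ ℕ ] Σ[ p ∈ List Letter ] Σ[ c ∈ Letter ] Σ[ s ∈ List Letter ] σ (σⁿ0 N) ≡ p ++ w ++ c ∷ s
  Factor′-inside-σ {w} (N , p , s , e) =
    let c , s′ , s++≡ = ++-NonEmpty s (++-NonEmpty (σⁿ0 N) (σⁿ-∷ N l0 (zeros a′ ++ l1 ∷ [])))
    in N , p , c , s′ , (begin
      σ (σⁿ0 N)                                     ≡⟨ σⁿ0-suc N ⟩
      σⁿ0 N ++ σⁿ0 N ++ σⁿ0-rest N                  ≡⟨ cong (_++ σⁿ0 N ++ σⁿ0-rest N) e ⟩
      (p ++ w ++ s) ++ σⁿ0 N ++ σⁿ0-rest N          ≡⟨ ++-assoc p (w ++ s) _ ⟩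
      p ++ (w ++ s) ++ σⁿ0 N ++ σⁿ0-rest N          ≡⟨ cong (p ++_) (trans (++-assoc w s _) (cong (w ++_) s++≡)) ⟩
      p ++ w ++ c ∷ s′                              ∎)
    where open ≡-Reasoning

  Factor′-zeros⇒≤a : ∀ k → Factor′ (zeros k) → k ≤ a
  Factor′-zeros⇒≤a k f =
    let N , p , c , s , e = Factor′-inside-σ f in σ-zero-run-≤ b≤a (σⁿ0 N) p k (c ∷ s) e

  ≤a⇒Factor′-zeros : ∀ k → k ≤ a → Factor′ (zeros k)
  ≤a⇒Factor′-zeros k k≤a = 1 , [] , zeros (a ∸ k) ++ l1 ∷ [] ,
    trans (cong (_++ l1 ∷ []) (zeros-splitˡ k k≤a)) (++-assoc (zeros k) (zeros (a ∸ k)) _)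

  Factor′-zeros-l1∷ : ∀ {i w} → Factor′ (zeros i ++ l1 ∷ w) →
    Σ[ v ∈ List Letter ] Σ[ j ∈ ℕ ] Σ[ x ∈ Letter ] Σ[ y ∈ Letter ]
      w ≡ σ v ++ zeros j × Factor′ (x ∷ v ++ y ∷ []) × i ≤ run x × j ≤ run y
  Factor′-zeros-l1∷ {i} {w} f =
    let N , p , c , s , e = Factor′-inside-σ f
        v , j , x , y , w≡ , x∷v∷ʳy⊑ , i≤ , j≤ = σ-desubstitute (σⁿ0 N) p i w c s e
    in v , j , x , y , w≡ , (N , x∷v∷ʳy⊑) , i≤ , j≤

  Factor′-zeros-l1∷σ-++-zeros : ∀ i j v x y → Factor′ (x ∷ v ++ y ∷ []) → i ≤ run x → j ≤ run y →
    Factor′ (zeros i ++ l1 ∷ σ v ++ zeros j)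
  Factor′-zeros-l1∷σ-++-zeros i j v x y (N , ⊑) i≤ j≤ =
    suc N , Infix-trans (Infix-zeros-l1∷σ-++-zeros i j v x y i≤ j≤) (Infix-σ ⊑)

  -- Palindromic extensions

  Extendable : Letter → List Letter → Set
  Extendable x w = Factor′ (wrap x w)

  Surrounded : ℕ → List Letter → Set
  Surrounded i v = ∃₂ λ x y → Factor′ (x ∷ v ++ y ∷ []) × i ≤ run x × i ≤ run y

  Factor′-T′⇒Surrounded : ∀ i v → Factor′ (T′ i v) → Surrounded i v
  Factor′-T′⇒Surrounded i v f with Factor′-zeros-l1∷ f
  ... | v′ , j , x , y , σv++≡ , fxy , i≤ , j≤ with σ-++-zeros-injective a≢b v v′ i j σv++≡
  ... | refl , refl = x , y , fxy , i≤ , j≤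

  Surrounded⇒Factor′-T′ : ∀ i v → Surrounded i v → Factor′ (T′ i v)
  Surrounded⇒Factor′-T′ i v (x , y , f , i≤ , i≤′) = Factor′-zeros-l1∷σ-++-zeros i i v x y f i≤ i≤′

  Surrounded-suc : ∀ {i v} → i ≢ a → i ≢ b → Surrounded i v → Surrounded (suc i) v
  Surrounded-suc {i} i≢a i≢b (x , y , f , i≤ , i≤′) = x , y , f , ≤∧≢⇒< i≤ (i≢run x) , ≤∧≢⇒< i≤′ (i≢run y)
    where
    i≢run : ∀ c → i ≢ run c
    i≢run l0 = i≢a
    i≢run l1 = i≢b

  b<run⇒l0 : ∀ {i} x → b < i → i ≤ run x → x ≡ l0
  b<run⇒l0 l0 _   _  = refl
  b<run⇒l0 l1 b<i i≤ = ⊥-elim (<⇒≱ b<i i≤)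

  Surrounded⇒Extendable-l0 : ∀ {i v} → b < i → Surrounded i v → Extendable l0 v
  Surrounded⇒Extendable-l0 b<i (x , y , f , i≤ , i≤′) with b<run⇒l0 x b<i i≤ | b<run⇒l0 y b<i i≤′
  ... | refl | refl = f

  Extendable-l0-T′⇔ : ∀ i v → Extendable l0 (T′ i v) ⇔ Surrounded (suc i) v
  Extendable-l0-T′⇔ i v = mk⇔
    (Factor′-T′⇒Surrounded (suc i) v ∘ subst Factor′ (wrap-l0-T′ i v))
    (subst Factor′ (sym (wrap-l0-T′ i v)) ∘ Surrounded⇒Factor′-T′ (suc i) v)

  Extendable-l0-zeros⇔ : ∀ k → Extendable l0 (zeros k) ⇔ suc (suc k) ≤ a
  Extendable-l0-zeros⇔ k = mk⇔
    (Factor′-zeros⇒≤a _ ∘ subst Factor′ (wrap-l0-zeros k))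
    (subst Factor′ (sym (wrap-l0-zeros k)) ∘ ≤a⇒Factor′-zeros _)

  Extendable-l1-T′ : ∀ c v → Extendable c v → Extendable l1 (T′ (run c) v)
  Extendable-l1-T′ c v f =
    let x , y , fxy = Factor′-extend f
    in subst Factor′ (sym (wrap-l1-T′ c v)) (Factor′-zeros-l1∷σ-++-zeros 0 0 (wrap c v) x y fxy z≤n z≤n)

  Extendable-l1-T′⇒ : ∀ i v → Extendable l1 (T′ i v) → ∃ λ c → run c ≡ i × Extendable c v
  Extendable-l1-T′⇒ i v f with Factor′-zeros-l1∷ {0} {T′ i v ++ l1 ∷ []} f
  ... | v′ , j , x , y , e , fxy , _
      with σ-++-zeros≡zeros-l1∷ v′ j i _ (trans (sym e) (++-l1∷-++-assoc (zeros i) (σ v) (zeros i) (l1 ∷ [])))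
  ... | c , v″ , refl , refl , σv″++≡ =
    c , refl , Factor′-infix fxy (x ∷ [] , y ∷ [] , cong (λ u → x ∷ c ∷ u ++ y ∷ []) v″≡)
    where
    v″≡ : v″ ≡ v ∷ʳ c
    v″≡ = proj₁ (σ-++-zeros-injective a≢b v″ (v ∷ʳ c) j 0
            (trans σv″++≡ (trans (sym (σ-∷ʳ v c)) (sym (++-identityʳ _)))))

  Extendable-l1-zeros : ∀ c → Extendable l1 (zeros (run c))
  Extendable-l1-zeros c =
    let x , y , f = Factor′-extend (Factor′-letter c)
    in subst Factor′ (sym (wrap-l1-zeros c)) (Factor′-zeros-l1∷σ-++-zeros 0 0 (c ∷ []) x y f z≤n z≤n)

  Extendable-l1-zeros⇒ : ∀ k → Extendable l1 (zeros k) → ∃ λ c → run c ≡ k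
  Extendable-l1-zeros⇒ k f =
    let v , j , _ , _ , e , _ = Factor′-zeros-l1∷ {0} {zeros k ++ l1 ∷ []} f
        c , _ , _ , run≡ , _ = σ-++-zeros≡zeros-l1∷ v j k [] (sym e)
    in c , run≡

  data Extensions (w : List Letter) : Set where
    both  : Extendable l0 w → Extendable l1 w → ∃ (λ k → w ≡ V k) → Extensions w
    none  : ¬ Extendable l0 w → ¬ Extendable l1 w → ∃ (λ k → w ≡ U k) → Extensions w
    only0 : Extendable l0 w → ¬ Extendable l1 w → Extensions w
    only1 : ¬ Extendable l0 w → Extendable l1 w → Extensions w

  run≢ : ∀ {k} → k ≢ a → k ≢ b → ∀ c → run c ≢ k
  run≢ k≢a k≢b l0 = k≢a ∘ sym
  run≢ k≢a k≢b l1 = k≢b ∘ sym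

  zeros-b-extendable : Extendable l0 (zeros b) × Extendable l1 (zeros b)
  zeros-b-extendable = from (Extendable-l0-zeros⇔ b) (s≤s (s≤s (s≤s b′≤a′))) , Extendable-l1-zeros l1

  zeros-a-1-unextendable : ¬ Extendable l0 (zeros (a ∸ 1)) × ¬ Extendable l1 (zeros (a ∸ 1))
  zeros-a-1-unextendable =
    (λ f → 1+n≰n (≤-pred (to (Extendable-l0-zeros⇔ (a ∸ 1)) f))) ,
    (λ f → let c , run≡ = Extendable-l1-zeros⇒ (a ∸ 1) f in run≢ (<⇒≢ (n<1+n (a ∸ 1))) (>⇒≢ b<a-1) c run≡)

  classify-zeros : ∀ k → k ≤ a → Extensions (zeros k)
  classify-zeros k k≤a with k ≟ b | k ≟ a ∸ 1 | k ≟ a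
  ... | yes refl | _ | _ = both (proj₁ zeros-b-extendable) (proj₂ zeros-b-extendable) (0 , refl)
  ... | no _ | yes refl | _ = none (proj₁ zeros-a-1-unextendable) (proj₂ zeros-a-1-unextendable) (0 , refl)
  ... | no _ | no _ | yes refl =
    only1 (λ f → 1+n≰n (≤-trans (n≤1+n _) (to (Extendable-l0-zeros⇔ a) f))) (Extendable-l1-zeros l0)
  ... | no k≢b | no k≢a-1 | no k≢a =
    only0 (from (Extendable-l0-zeros⇔ k) (s≤s (≤∧≢⇒< (≤-pred (≤∧≢⇒< k≤a k≢a)) k≢a-1)))
          (λ f → let c , run≡ = Extendable-l1-zeros⇒ k f in run≢ k≢a k≢b c run≡)

  Extendable-l0-T′b⇔ : ∀ v → Extendable l0 (T′ b v) ⇔ Extendable l0 v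
  Extendable-l0-T′b⇔ v = mk⇔
    (Surrounded⇒Extendable-l0 ≤-refl ∘ to (Extendable-l0-T′⇔ b v))
    (λ f → from (Extendable-l0-T′⇔ b v) (l0 , l0 , f , b<a , b<a))

  Extendable-l1-T′b⇔ : ∀ v → Extendable l1 (T′ b v) ⇔ Extendable l1 v
  Extendable-l1-T′b⇔ v = mk⇔ from-T′ (Extendable-l1-T′ l1 v)
    where
    from-T′ : Extendable l1 (T′ b v) → Extendable l1 v
    from-T′ f with Extendable-l1-T′⇒ b v f
    ... | c , run≡ , fc with run-injective a≢b c l1 run≡
    ... | refl = fc

  classify-T′b : ∀ {v} → Extensions v → Extensions (T′ b v)
  classify-T′b {v} (both e0 e1 (k , refl)) =
    both (from (Extendable-l0-T′b⇔ v) e0) (from (Extendable-l1-T′b⇔ v) e1) (suc k , sym (T≡T′b v))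
  classify-T′b {v} (none n0 n1 (k , refl)) =
    none (n0 ∘ to (Extendable-l0-T′b⇔ v)) (n1 ∘ to (Extendable-l1-T′b⇔ v)) (suc k , sym (T≡T′b v))
  classify-T′b {v} (only0 e0 n1) = only0 (from (Extendable-l0-T′b⇔ v) e0) (n1 ∘ to (Extendable-l1-T′b⇔ v))
  classify-T′b {v} (only1 n0 e1) = only1 (n0 ∘ to (Extendable-l0-T′b⇔ v)) (from (Extendable-l1-T′b⇔ v) e1)

  classify-T′ : ∀ i {v} → Surrounded i v → Extensions v → Extensions (T′ i v)
  classify-T′ i {v} s ext with i ≟ b | i ≟ a
  ... | yes refl | _ = classify-T′b ext
  ... | no _ | yes refl =
    only1 (λ f → let x , _ , _ , a<run , _ = to (Extendable-l0-T′⇔ a v) f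
                 in 1+n≰n (≤-trans a<run (run-≤ b≤a x)))
          (Extendable-l1-T′ l0 v (Surrounded⇒Extendable-l0 b<a s))
  ... | no i≢b | no i≢a =
    only0 (from (Extendable-l0-T′⇔ i v) (Surrounded-suc i≢a i≢b s))
          (λ f → let c , run≡ , _ = Extendable-l1-T′⇒ i v f in run≢ i≢a i≢b c run≡)

  length-<-T′ : ∀ i v → length v < length (T′ i v)
  length-<-T′ i v = subst (_≤ length (T′ i v)) (#₁-T′ i v) (#₁≤length (T′ i v))

  classify : ∀ w → Palindrome w → Factor′ w → Extensions w
  classify w = go w (<-wellFounded (length w))
    where
    go : ∀ w → Acc _<_ (length w) → Palindrome w → Factor′ w → Extensions w
    go w (acc rec) pal f with zerosView w
    ... | all-zeros k = classify-zeros k (Factor′-zeros⇒≤a k f)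
    ... | zeros-l1∷ i w′ with Factor′-zeros-l1∷ f
    ... | v , j , x , y , refl , fxy , i≤ , j≤ with palindrome-zeros-l1∷σ-++-zeros a≢b i v j pal
    ... | refl , pal-v = classify-T′ i (x , y , fxy , i≤ , j≤)
                           (go v (rec (length-<-T′ i v)) pal-v (Factor′-infix fxy (x ∷ [] , y ∷ [] , refl)))

  PalindromicFactor : List Letter → Set
  PalindromicFactor w = Palindrome w × Factor′ w

  T′b-palindromic-factor : ∀ {v} → PalindromicFactor v → PalindromicFactor (T′ b v)
  T′b-palindromic-factor {v} (pal , f) =
    let x , y , fxy = Factor′-extend f
    in T′-palindrome b v pal , Surrounded⇒Factor′-T′ b v (x , y , fxy , b≤run x , b≤run y)

  V-palindromic-factor : ∀ k → PalindromicFactor (V k)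
  V-palindromic-factor zero    = reverse-zeros b , ≤a⇒Factor′-zeros b b≤a
  V-palindromic-factor (suc k) =
    subst PalindromicFactor (sym (T≡T′b (V k))) (T′b-palindromic-factor (V-palindromic-factor k))

  U-palindromic-factor : ∀ k → PalindromicFactor (U k)
  U-palindromic-factor zero    = reverse-zeros (a ∸ 1) , ≤a⇒Factor′-zeros (a ∸ 1) (n≤1+n (a ∸ 1))
  U-palindromic-factor (suc k) =
    subst PalindromicFactor (sym (T≡T′b (U k))) (T′b-palindromic-factor (U-palindromic-factor k))

  V-extendable : ∀ k → Extendable l0 (V k) × Extendable l1 (V k)
  V-extendable zero    = zeros-b-extendable
  V-extendable (suc k) =
    let e0 , e1 = V-extendable k
    in subst (λ w → Extendable l0 w × Extendable l1 w) (sym (T≡T′b (V k)))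
             (from (Extendable-l0-T′b⇔ (V k)) e0 , from (Extendable-l1-T′b⇔ (V k)) e1)

  U-unextendable : ∀ k → ¬ Extendable l0 (U k) × ¬ Extendable l1 (U k)
  U-unextendable zero    = zeros-a-1-unextendable
  U-unextendable (suc k) =
    let n0 , n1 = U-unextendable k
    in subst (λ w → ¬ Extendable l0 w × ¬ Extendable l1 w) (sym (T≡T′b (U k)))
             (n0 ∘ to (Extendable-l0-T′b⇔ (U k)) , n1 ∘ to (Extendable-l1-T′b⇔ (U k)))

  -- Lengths of V k and U k

  V≺U : ∀ k → V k ≺ U k
  V≺U zero    = ≺-intro
    (subst₂ _≤_ (sym (#₀-zeros b)) (sym (#₀-zeros (a ∸ 1))) (<⇒≤ b<a-1))
    (subst₂ _≤_ (sym (#₁-zeros b)) (sym (#₁-zeros (a ∸ 1))) z≤n)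
    (subst₂ _<_ (sym (length-zeros b)) (sym (length-zeros (a ∸ 1))) b<a-1)
  V≺U (suc k) = subst₂ _≺_ (sym (T≡T′b (V k))) (sym (T≡T′b (U k))) (T′-mono-≺ b (V≺U k))

  U≺V : ∀ k → U k ≺ V (suc k)
  U≺V zero    = subst (zeros (a ∸ 1) ≺_) (sym (T≡T′b (zeros b))) (≺-from-counts #₀≤ #₁<)
    where
    #₀≤ : #₀ (zeros (a ∸ 1)) ≤ #₀ (T′ b (zeros b))
    #₀≤ = begin
      #₀ (zeros (a ∸ 1))             ≡⟨ #₀-zeros (a ∸ 1) ⟩
      a ∸ 1                          ≤⟨ n≤1+n (a ∸ 1) ⟩
      a                              ≤⟨ m≤m*n a b ⟩
      a * b                          ≤⟨ m≤m+n (a * b) (b * 0) ⟩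
      a * b + b * 0                  ≡⟨ cong₂ (λ s t → a * s + b * t) (#₀-zeros b) (#₁-zeros b) ⟨
      a * #₀ (zeros b) + b * #₁ (zeros b) ≡⟨ #₀-σ (zeros b) ⟨
      #₀ (σ (zeros b))               ≤⟨ m≤n+m _ b ⟩
      b + #₀ (σ (zeros b))           ≤⟨ +-monoʳ-≤ b (m≤m+n _ b) ⟩
      b + (#₀ (σ (zeros b)) + b)     ≡⟨ #₀-T′ b (zeros b) ⟨
      #₀ (T′ b (zeros b))            ∎
      where open ≤-Reasoning
    #₁< : #₁ (zeros (a ∸ 1)) < #₁ (T′ b (zeros b))
    #₁< = subst₂ _<_ (sym (#₁-zeros (a ∸ 1))) (sym (#₁-T′ b (zeros b))) (s≤s z≤n)
  U≺V (suc k) = subst₂ _≺_ (sym (T≡T′b (U k))) (sym (T≡T′b (V (suc k)))) (T′-mono-≺ b (U≺V k))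

  length-V<length-V-suc : ∀ k → length (V k) < length (V (suc k))
  length-V<length-V-suc k = <-trans (length-< (V≺U k)) (length-< (U≺V k))

  length-U<length-U-suc : ∀ k → length (U k) < length (U (suc k))
  length-U<length-U-suc k = <-trans (length-< (U≺V k)) (length-< (V≺U (suc k)))

  length-V-mono-≤ : ∀ {j k} → j ≤ k → length (V j) ≤ length (V k)
  length-V-mono-≤ = increasing⇒≤ (λ k → length (V k)) length-V<length-V-suc

  length-V-injective : ∀ j k → length (V j) ≡ length (V k) → j ≡ k
  length-V-injective j k = increasing⇒injective (λ k → length (V k)) length-V<length-V-suc

  length-U-injective : ∀ j k → length (U j) ≡ length (U k) → j ≡ k
  length-U-injective j k = increasing⇒injective (λ k → length (U k)) length-U<length-U-suc

  length-V≢length-U : ∀ k j → length (V k) ≢ length (U j)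
  length-V≢length-U k j with k ≤? j
  ... | yes k≤j = <⇒≢ (≤-<-trans (length-V-mono-≤ k≤j) (length-< (V≺U j)))
  ... | no  k≰j = >⇒≢ (<-≤-trans (length-< (U≺V j)) (length-V-mono-≤ (≰⇒> k≰j)))

  ≢V-of-length-V : ∀ {w} k → length w ≡ length (V k) → w ≢ V k → ∀ j → w ≢ V j
  ≢V-of-length-V k |w| w≢ j refl = w≢ (cong V (length-V-injective j k |w|))

  ≢U-of-length-V : ∀ {w} k → length w ≡ length (V k) → ∀ j → w ≢ U j
  ≢U-of-length-V k |w| j refl = length-V≢length-U k j (sym |w|)

  ≢U-of-length-U : ∀ {w} k → length w ≡ length (U k) → w ≢ U k → ∀ j → w ≢ U j
  ≢U-of-length-U k |w| w≢ j refl = w≢ (cong U (length-U-injective j k |w|))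

  ≢V-of-length-U : ∀ {w} k → length w ≡ length (U k) → ∀ j → w ≢ V j
  ≢V-of-length-U k |w| j refl = length-V≢length-U j k |w|

  -- Counting palindromic factors

  PalFactor : Set
  PalFactor = Σ (List Letter) PalindromicFactor

  extendable? : ∀ x (e : PalFactor) → Dec (Extendable x (proj₁ e))
  extendable? x (w , pal , f) = decide x (classify w pal f)
    where
    decide : ∀ x → Extensions w → Dec (Extendable x w)
    decide l0 (both e0 _ _) = yes e0
    decide l1 (both _ e1 _) = yes e1
    decide l0 (none n0 _ _) = no n0
    decide l1 (none _ n1 _) = no n1
    decide l0 (only0 e0 _)  = yes e0
    decide l1 (only0 _ n1)  = no n1
    decide l0 (only1 n0 _)  = no n0
    decide l1 (only1 _ e1)  = yes e1

  extend : Letter → List PalFactor → List PalFactor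
  extend x []                    = []
  extend x ((w , pal , f) ∷ L) with extendable? x (w , pal , f)
  ... | yes ext = (wrap x w , wrap-palindrome x w pal , ext) ∷ extend x L
  ... | no _    = extend x L

  palindromes : ℕ → List PalFactor
  palindromes zero          = ([] , refl , Factor′-[]) ∷ []
  palindromes (suc zero)    = (l0 ∷ [] , refl , Factor′-letter l0) ∷ (l1 ∷ [] , refl , Factor′-letter l1) ∷ []
  palindromes (suc (suc n)) = extend l0 (palindromes n) ++ extend l1 (palindromes n)

  words : List PalFactor → List (List Letter)
  words = map proj₁

  extend-length : ∀ x {n} L → All (λ e → length (proj₁ e) ≡ n) L →
    All (λ e → length (proj₁ e) ≡ suc (suc n)) (extend x L)
  extend-length x []                   []           = []
  extend-length x ((w , pal , f) ∷ L) (|w| ∷ |L|) with extendable? x (w , pal , f)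
  ... | yes _ = trans (length-wrap x w) (cong (suc ∘ suc) |w|) ∷ extend-length x L |L|
  ... | no _  = extend-length x L |L|

  palindromes-length : ∀ n → All (λ e → length (proj₁ e) ≡ n) (palindromes n)
  palindromes-length zero          = refl ∷ []
  palindromes-length (suc zero)    = refl ∷ refl ∷ []
  palindromes-length (suc (suc n)) =
    AllP.++⁺ (extend-length l0 (palindromes n) (palindromes-length n))
             (extend-length l1 (palindromes n) (palindromes-length n))

  ∈-extend⁻ : ∀ x L {z} → z ∈ words (extend x L) → ∃ λ m → m ∈ words L × z ≡ wrap x m
  ∈-extend⁻ x ((w , pal , f) ∷ L) z∈ with extendable? x (w , pal , f) | z∈
  ... | yes _ | here refl = w , here refl , refl
  ... | yes _ | there z∈′ = let m , m∈ , z≡ = ∈-extend⁻ x L z∈′ in m , there m∈ , z≡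
  ... | no _  | z∈′       = let m , m∈ , z≡ = ∈-extend⁻ x L z∈′ in m , there m∈ , z≡

  ∈-extend⁺ : ∀ x L {m} → m ∈ words L → Extendable x m → wrap x m ∈ words (extend x L)
  ∈-extend⁺ x ((w , pal , f) ∷ L) m∈ ext with extendable? x (w , pal , f) | m∈
  ... | yes _ | here refl = here refl
  ... | yes _ | there m∈′ = there (∈-extend⁺ x L m∈′ ext)
  ... | no ¬ext | here refl = ⊥-elim (¬ext ext)
  ... | no _    | there m∈′ = ∈-extend⁺ x L m∈′ ext

  extend-unique : ∀ x L → Unique (words L) → Unique (words (extend x L))
  extend-unique x []                   []               = []
  extend-unique x ((w , pal , f) ∷ L) (w∉ ∷ unique) with extendable? x (w , pal , f)
  ... | yes _ = All.tabulate wrap-w∉ ∷ extend-unique x L unique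
    where
    wrap-w∉ : ∀ {z} → z ∈ words (extend x L) → wrap x w ≢ z
    wrap-w∉ z∈ e with ∈-extend⁻ x L z∈
    ... | m , m∈ , refl = All.lookup w∉ m∈ (wrap-injective x w m e)
  ... | no _ = extend-unique x L unique

  palindromes-unique : ∀ n → Unique (words (palindromes n))
  palindromes-unique zero          = [] ∷ []
  palindromes-unique (suc zero)    = ((λ ()) ∷ []) ∷ [] ∷ []
  palindromes-unique (suc (suc n)) =
    subst Unique (sym (map-++ proj₁ (extend l0 (palindromes n)) (extend l1 (palindromes n))))
      (Unique.++⁺ (extend-unique l0 P (palindromes-unique n)) (extend-unique l1 P (palindromes-unique n))
        λ (z∈₀ , z∈₁) → first-letters-differ (∈-extend⁻ l0 P z∈₀) (∈-extend⁻ l1 P z∈₁))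
    where
    P = palindromes n
    first-letters-differ : ∀ {z} → (∃ λ m → m ∈ words P × z ≡ wrap l0 m) →
                                   (∃ λ m → m ∈ words P × z ≡ wrap l1 m) → ⊥
    first-letters-differ (_ , _ , refl) (_ , _ , ())

  wrap-∈-palindromes : ∀ n x {m} → m ∈ words (palindromes n) → Extendable x m →
    wrap x m ∈ words (palindromes (suc (suc n)))
  wrap-∈-palindromes n x {m} m∈ ext =
    subst (wrap x m ∈_) (sym (map-++ proj₁ (extend l0 (palindromes n)) (extend l1 (palindromes n))))
      (by-letter x ext)
    where
    by-letter : ∀ x → Extendable x m →
      wrap x m ∈ words (extend l0 (palindromes n)) ++ words (extend l1 (palindromes n))
    by-letter l0 e = ∈-++⁺ˡ (∈-extend⁺ l0 (palindromes n) m∈ e)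
    by-letter l1 e = ∈-++⁺ʳ _ (∈-extend⁺ l1 (palindromes n) m∈ e)

  palindromes-complete : ∀ n w → length w ≡ n → PalindromicFactor w → w ∈ words (palindromes n)
  wrap-complete : ∀ n x m y → length (x ∷ m ++ y ∷ []) ≡ suc (suc n) →
    PalindromicFactor (x ∷ m ++ y ∷ []) → x ∷ m ++ y ∷ [] ∈ words (palindromes (suc (suc n)))

  palindromes-complete zero          []           _   _  = here refl
  palindromes-complete (suc zero)    (l0 ∷ [])    _   _  = here refl
  palindromes-complete (suc zero)    (l1 ∷ [])    _   _  = there (here refl)
  palindromes-complete (suc (suc n)) (x ∷ c ∷ cs) |w| pf =
    let m , y , c∷cs≡ = ∷-∷ʳ-view c cs
    in subst (λ t → x ∷ t ∈ words (palindromes (suc (suc n)))) (sym c∷cs≡)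
         (wrap-complete n x m y (subst (λ t → length (x ∷ t) ≡ suc (suc n)) c∷cs≡ |w|)
                                (subst (λ t → PalindromicFactor (x ∷ t)) c∷cs≡ pf))

  wrap-complete n x m y |w| (pal , f) with palindrome-unwrap x m y pal
  ... | refl , pal-m = wrap-∈-palindromes n x
          (palindromes-complete n m |m| (pal-m , Factor′-infix f (x ∷ [] , x ∷ [] , refl))) f
    where
    |m| : length m ≡ n
    |m| = suc-injective (suc-injective (trans (sym (length-wrap x m)) |w|))

  palCount : ∀ n → PalCount n (length (palindromes n))
  palCount n = words (palindromes n) , palindromes-unique n , length-map proj₁ (palindromes n) ,
    λ w → mk⇔ (sound w) (complete w)
    where
    sound : ∀ w → w ∈ words (palindromes n) → length w ≡ n × Palindrome w × Factor w
    sound w w∈ with ∈-map⁻ proj₁ w∈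
    ... | (w , pal , f) , e∈ , refl = All.lookup (palindromes-length n) e∈ , pal , Factor′⇒Factor w f
    complete : ∀ w → length w ≡ n × Palindrome w × Factor w → w ∈ words (palindromes n)
    complete w (|w| , pal , fac) = palindromes-complete n w |w| (pal , Factor⇒Factor′ w fac)

  #extensions : PalFactor → ℕ
  #extensions e = length (extend l0 (e ∷ [])) + length (extend l1 (e ∷ []))

  length-extend-∷ : ∀ x e L → length (extend x (e ∷ L)) ≡ length (extend x (e ∷ [])) + length (extend x L)
  length-extend-∷ x (w , pal , f) L with extendable? x (w , pal , f)
  ... | yes _ = refl
  ... | no _  = refl

  length-palindromes-suc-suc : ∀ n → length (palindromes (suc (suc n))) ≡ sum (map #extensions (palindromes n))
  length-palindromes-suc-suc n = trans (length-++ (extend l0 (palindromes n))) (count (palindromes n))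
    where
    ℓ : Letter → List PalFactor → ℕ
    ℓ x L = length (extend x L)
    interchange : ∀ w x y z → (w + x) + (y + z) ≡ (w + y) + (x + z)
    interchange = solve-∀
    count : ∀ L → ℓ l0 L + ℓ l1 L ≡ sum (map #extensions L)
    count []      = refl
    count (e ∷ L) = begin
      ℓ l0 (e ∷ L) + ℓ l1 (e ∷ L)
        ≡⟨ cong₂ _+_ (length-extend-∷ l0 e L) (length-extend-∷ l1 e L) ⟩
      (ℓ l0 (e ∷ []) + ℓ l0 L) + (ℓ l1 (e ∷ []) + ℓ l1 L)
        ≡⟨ interchange (ℓ l0 (e ∷ [])) (ℓ l0 L) (ℓ l1 (e ∷ [])) (ℓ l1 L) ⟩
      #extensions e + (ℓ l0 L + ℓ l1 L)
        ≡⟨ cong (_+_ (#extensions e)) (count L) ⟩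
      #extensions e + sum (map #extensions L) ∎
      where open ≡-Reasoning

  length-extend-[-]-yes : ∀ x e → Extendable x (proj₁ e) → length (extend x (e ∷ [])) ≡ 1
  length-extend-[-]-yes x (w , pal , f) ext with extendable? x (w , pal , f)
  ... | yes _   = refl
  ... | no ¬ext = ⊥-elim (¬ext ext)

  length-extend-[-]-no : ∀ x e → ¬ Extendable x (proj₁ e) → length (extend x (e ∷ [])) ≡ 0
  length-extend-[-]-no x (w , pal , f) ¬ext with extendable? x (w , pal , f)
  ... | yes ext = ⊥-elim (¬ext ext)
  ... | no _    = refl

  #extensions-V : ∀ k e → proj₁ e ≡ V k → #extensions e ≡ 2
  #extensions-V k e refl = let e0 , e1 = V-extendable k in
    cong₂ _+_ (length-extend-[-]-yes l0 e e0) (length-extend-[-]-yes l1 e e1)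

  #extensions-U : ∀ k e → proj₁ e ≡ U k → #extensions e ≡ 0
  #extensions-U k e refl = let n0 , n1 = U-unextendable k in
    cong₂ _+_ (length-extend-[-]-no l0 e n0) (length-extend-[-]-no l1 e n1)

  #extensions-otherwise : ∀ e → (∀ k → proj₁ e ≢ V k) → (∀ k → proj₁ e ≢ U k) → #extensions e ≡ 1
  #extensions-otherwise e@(w , pal , f) ≢V ≢U = count (classify w pal f)
    where
    count : Extensions w → #extensions e ≡ 1
    count (both _ _ (k , w≡)) = ⊥-elim (≢V k w≡)
    count (none _ _ (k , w≡)) = ⊥-elim (≢U k w≡)
    count (only0 e0 n1) = cong₂ _+_ (length-extend-[-]-yes l0 e e0) (length-extend-[-]-no l1 e n1)
    count (only1 n0 e1) = cong₂ _+_ (length-extend-[-]-no l0 e n0) (length-extend-[-]-yes l1 e e1)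

  palindromes-growth-V : ∀ n k → n ≡ length (V k) →
    length (palindromes (suc (suc n))) + 1 ≡ length (palindromes n) + 2
  palindromes-growth-V n k n≡ = trans (cong (_+ 1) (length-palindromes-suc-suc n))
    (sum-map-ones-but-one proj₁ #extensions (palindromes n) (palindromes-unique n)
      (palindromes-complete n (V k) (sym n≡) (V-palindromic-factor k))
      (#extensions-V k) (All.map (λ {e} → one-extension {e}) (palindromes-length n)))
    where
    one-extension : ∀ {e} → length (proj₁ e) ≡ n → proj₁ e ≢ V k → #extensions e ≡ 1
    one-extension {e} |e| e≢ = #extensions-otherwise e
      (≢V-of-length-V k (trans |e| n≡) e≢) (≢U-of-length-V k (trans |e| n≡))

  palindromes-growth-U : ∀ n k → n ≡ length (U k) →
    length (palindromes (suc (suc n))) + 1 ≡ length (palindromes n) + 0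
  palindromes-growth-U n k n≡ = trans (cong (_+ 1) (length-palindromes-suc-suc n))
    (sum-map-ones-but-one proj₁ #extensions (palindromes n) (palindromes-unique n)
      (palindromes-complete n (U k) (sym n≡) (U-palindromic-factor k))
      (#extensions-U k) (All.map (λ {e} → one-extension {e}) (palindromes-length n)))
    where
    one-extension : ∀ {e} → length (proj₁ e) ≡ n → proj₁ e ≢ U k → #extensions e ≡ 1
    one-extension {e} |e| e≢ = #extensions-otherwise e
      (≢V-of-length-U k (trans |e| n≡)) (≢U-of-length-U k (trans |e| n≡) e≢)

  palindromes-growth-otherwise : ∀ n → (∀ k → n ≢ length (V k)) → (∀ k → n ≢ length (U k)) →
    length (palindromes (suc (suc n))) + 1 ≡ length (palindromes n) + 1
  palindromes-growth-otherwise n ≢V ≢U = cong (_+ 1) (trans (length-palindromes-suc-suc n)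
    (sum-map-ones #extensions {palindromes n} (All.map (λ {e} → one-extension {e}) (palindromes-length n))))
    where
    one-extension : ∀ {e} → length (proj₁ e) ≡ n → #extensions e ≡ 1
    one-extension {e} |e| = #extensions-otherwise e
      (λ j e≡ → ≢V j (trans (sym |e|) (cong length e≡)))
      (λ j e≡ → ≢U j (trans (sym |e|) (cong length e≡)))

corollary5p7 : (a b : ℕ) → 1 ≤ b → b < a ∸ 1 →
    let open Sturm a b in
    (n : ℕ) → 1 ≤ n →
    Σ ℕ λ p → Σ ℕ λ q → PalCount (n + 2) p × PalCount n q ×
      ((∀ k → n ≡ length (V k) → (+ p - + q) ≡ + 1) ×
       (∀ k → n ≡ length (U k) → (+ p - + q) ≡ - (+ 1)) ×
       ((∀ k → n ≢ length (V k)) → (∀ k → n ≢ length (U k)) → (+ p - + q) ≡ + 0))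
corollary5p7 (suc (suc (suc a′))) (suc b′) _ (s≤s (s≤s b′≤a′)) n _ =
  length (palindromes (suc (suc n))) , length (palindromes n) ,
  subst (λ m → PalCount m (length (palindromes (suc (suc n))))) (+-comm 2 n) (palCount (suc (suc n))) ,
  palCount n ,
  (λ k n≡ → +p-+q≡+m-+1 _ _ 2 (palindromes-growth-V n k n≡)) ,
  (λ k n≡ → +p-+q≡+m-+1 _ _ 0 (palindromes-growth-U n k n≡)) ,
  (λ ≢V ≢U → +p-+q≡+m-+1 _ _ 1 (palindromes-growth-otherwise n ≢V ≢U))
  where
  open PalindromicFactors a′ b′ b′≤a′
  open Sturm (3 + a′) (1 + b′) using (PalCount)
corollary5p7 zero                _       _   ()
corollary5p7 (suc zero)          _       _   ()
corollary5p7 (suc (suc zero))    (suc _) _   (s≤s ())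
corollary5p7 (suc (suc (suc _))) zero    ()  _
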